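{- Let $n$ be an odd integer and let $X\subseteq V(M_n)$ have order $|X|\le n/4$. Then there exists a family $\{M(x):x\in X\}$ of pairwise vertex-disjoint subgraphs of $M_n$ such that for each $x\in X$ there exists $i(x)\le 2(|X|-1)$ with $M(x)\cong M_{n-i(x)}$, and $x\in V(M(x))$ for all $x\in X$.
   Context: For odd $n$ and $k=\frac{n-1}{2}$, the middle layers graph $M_n$ is the bipartite graph whose vertex classes are the $k$-element subsets and the $(k+1)$-element subsets of $[n]$, where a $k$-subset is adjacent to each $(k+1)$-subset containing it. -}

module Defs where

open import Level using (0ℓ)
open import Data.Nat using (ℕ; suc; _*_; _∸_; _≤_)
open import Data.Sum using (_⊎_)
open import Data.Product using (_×_; Σ; ∃; ∃-syntax)
open import Data.List using (List; length)
open import Data.List.Membership.Propositional using (_∈_)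
open import Data.Empty using (⊥)
open import Relation.Binary.PropositionalEquality using (_≡_; _≢_)
open import Function.Bundles using (_⇔_)
open import Data.Fin.Subset using (Subset; ∣_∣; _⊆_)

-- The ground set size of the middle layers graph M_n with n odd:
-- n = dim k = 2k+1, and the middle layers are k and k+1.
dim : ℕ → ℕ
dim k = suc (2 * k)

IsVertex : (k : ℕ) → Subset (dim k) → Set
IsVertex k A = ∣ A ∣ ≡ k ⊎ ∣ A ∣ ≡ suc k

Adj : (k : ℕ) → Subset (dim k) → Subset (dim k) → Set
Adj k A B = (∣ A ∣ ≡ k × ∣ B ∣ ≡ suc k × A ⊆ B)
          ⊎ (∣ B ∣ ≡ k × ∣ A ∣ ≡ suc k × B ⊆ A)

record Subgraph (k : ℕ) : Set₁ where
  field
    V   : Subset (dim k) → Set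
    E   : Subset (dim k) → Subset (dim k) → Set
    V⊆  : ∀ A → V A → IsVertex k A
    E⊆  : ∀ A B → E A B → Adj k A B × V A × V B
open Subgraph public

record IsoToM {k : ℕ} (H : Subgraph k) (k' : ℕ) : Set where
  field
    f     : Subset (dim k) → Subset (dim k')
    g     : Subset (dim k') → Subset (dim k)
    f-vtx : ∀ A → V H A → IsVertex k' (f A)
    g-vtx : ∀ B → IsVertex k' B → V H (g B)
    gf    : ∀ A → V H A → g (f A) ≡ A
    fg    : ∀ B → IsVertex k' B → f (g B) ≡ B
    edges : ∀ A B → V H A → V H B → (E H A B ⇔ Adj k' (f A) (f B))

Disjoint : {k : ℕ} → Subgraph k → Subgraph k → Set
Disjoint H H' = ∀ A → V H A → V H' A → ⊥

module Submission where

-- Give each x ∈ X the subcube Q(x) through x obtained by freezing a set F(x) of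
-- coordinates at their values in x, and let M(x) be its intersection with the middle
-- layers. For every other y ∈ X, F(x) contains the first coordinate at which x and y
-- differ; y freezes that same coordinate at the opposite value, so M(x) and M(y) are
-- disjoint. This freezes at most |X| - 1 coordinates. Since |X| ≤ n/4, x has at least
-- |X| - 1 ones and zeros, so F(x) can be padded to exactly j = |X| - 1 coordinates where
-- x is 1 and j where x is 0. Then Q(x) is a cube of dimension n - 2j, and the vertices
-- of M(x) have exactly j more ones than their projection onto the free coordinates,
-- which therefore lies in the middle layers of that cube: M(x) ≅ M_{n-2j}.

open import Defs
open import Data.Nat using (ℕ; zero; suc; _*_; _+_; _∸_; _≤_; _<_; z≤n; s≤s; s≤s⁻¹)
open import Data.Nat.Properties
open import Data.Nat.Solver using (module +-*-Solver)
open import Data.Bool using (true; false; not)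
open import Data.Bool.Properties using (not-involutive)
open import Data.Product using (_×_; _,_; proj₁; proj₂; Σ; ∃-syntax)
open import Data.Product.Function.NonDependent.Propositional using (_×-⇔_)
open import Data.Sum using (inj₁; inj₂)
open import Data.Sum.Function.Propositional using (_⊎-⇔_)
open import Data.List using (List; []; _∷_; length; map)
open import Data.List.Membership.Propositional using (_∈_)
open import Data.List.Relation.Unary.Any as Any using ()
open import Data.List.Relation.Unary.All using (All)
import Data.List.Relation.Unary.All as All
open import Data.List.Relation.Unary.Unique.Propositional using (Unique)
open import Data.Vec using ([]; _∷_; here)
import Data.Vec.Properties as Vec
open import Data.Fin.Subset using (Subset; ∣_∣; _⊆_; _⊈_; _∩_; _∪_; ∁; ⋃; ⊥)
open import Data.Fin.Subset.Properties
  using (⊆-refl; ⊆-trans; ⊆-antisym; ∩-assoc; p∩q⊆p; x∈p∩q⁺; p⊆p∪q; q⊆p∪q;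
         ∣p∣≤∣x∷p∣; ∣⊥∣≡0; ∣p∩q∣≤∣p∣; ∣p∩q∣≤∣q∣; ∣∁p∣≡n∸∣p∣; in⊆in-⇔; out⊆-⇔; in⊆in; out⊆)
open import Function.Bundles using (_⇔_; mk⇔; Equivalence)
import Function.Properties.Equivalence as ⇔
open import Function.Base using (_∘_)
open import Relation.Binary.PropositionalEquality
open import Data.Empty using (⊥-elim)

private
  variable
    m n : ℕ

-- Subcubes

-- AgreeOn F A c: A lies in the subcube through c whose coordinates in F are frozen.
AgreeOn : Subset n → Subset n → Subset n → Set
AgreeOn F A c = F ∩ A ≡ F ∩ c

p⊆q⇒p∩q≡p : {p q : Subset n} → p ⊆ q → p ∩ q ≡ p
p⊆q⇒p∩q≡p {p = p} {q} p⊆q = ⊆-antisym (p∩q⊆p p q) (λ x∈p → x∈p∩q⁺ (x∈p , p⊆q x∈p))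

AgreeOn-antimono : {F G A c : Subset n} → G ⊆ F → AgreeOn F A c → AgreeOn G A c
AgreeOn-antimono {F = F} {G} {A} {c} G⊆F A~c = begin
  G ∩ A         ≡⟨ cong (_∩ A) (p⊆q⇒p∩q≡p G⊆F) ⟨
  (G ∩ F) ∩ A   ≡⟨ ∩-assoc G F A ⟩
  G ∩ (F ∩ A)   ≡⟨ cong (G ∩_) A~c ⟩
  G ∩ (F ∩ c)   ≡⟨ ∩-assoc G F c ⟨
  (G ∩ F) ∩ c   ≡⟨ cong (_∩ c) (p⊆q⇒p∩q≡p G⊆F) ⟩
  G ∩ c         ∎
  where open ≡-Reasoning

restrict : (F : Subset n) → Subset n → Subset ∣ ∁ F ∣
restrict []          []      = []
restrict (true  ∷ F) (_ ∷ A) = restrict F A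
restrict (false ∷ F) (a ∷ A) = a ∷ restrict F A

extend : (F : Subset n) → Subset n → Subset ∣ ∁ F ∣ → Subset n
extend []          []      []      = []
extend (true  ∷ F) (a ∷ c) B       = a ∷ extend F c B
extend (false ∷ F) (_ ∷ c) (b ∷ B) = b ∷ extend F c B

restrict-extend : (F c : Subset n) (B : Subset ∣ ∁ F ∣) → restrict F (extend F c B) ≡ B
restrict-extend []          []      []      = refl
restrict-extend (true  ∷ F) (_ ∷ c) B       = restrict-extend F c B
restrict-extend (false ∷ F) (_ ∷ c) (b ∷ B) = cong (b ∷_) (restrict-extend F c B)

extend-restrict : (F A c : Subset n) → AgreeOn F A c → extend F c (restrict F A) ≡ A
extend-restrict []          []      []      _   = refl
extend-restrict (true  ∷ F) (a ∷ A) (_ ∷ c) A~c =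
  cong₂ _∷_ (sym (Vec.∷-injectiveˡ A~c)) (extend-restrict F A c (Vec.∷-injectiveʳ A~c))
extend-restrict (false ∷ F) (a ∷ A) (_ ∷ c) A~c =
  cong (a ∷_) (extend-restrict F A c (Vec.∷-injectiveʳ A~c))

extend-agrees : (F c : Subset n) (B : Subset ∣ ∁ F ∣) → AgreeOn F (extend F c B) c
extend-agrees []          []      []      = refl
extend-agrees (true  ∷ F) (a ∷ c) B       = cong (a ∷_) (extend-agrees F c B)
extend-agrees (false ∷ F) (_ ∷ c) (_ ∷ B) = cong (false ∷_) (extend-agrees F c B)

∣extend∣ : (F c : Subset n) (B : Subset ∣ ∁ F ∣) → ∣ extend F c B ∣ ≡ ∣ F ∩ c ∣ + ∣ B ∣
∣extend∣ []          []          []          = refl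
∣extend∣ (true  ∷ F) (true  ∷ c) B           = cong suc (∣extend∣ F c B)
∣extend∣ (true  ∷ F) (false ∷ c) B           = ∣extend∣ F c B
∣extend∣ (false ∷ F) (_ ∷ c)     (true  ∷ B) = trans (cong suc (∣extend∣ F c B)) (sym (+-suc _ _))
∣extend∣ (false ∷ F) (_ ∷ c)     (false ∷ B) = ∣extend∣ F c B

∷-⊆-cancel : ∀ s {p q : Subset n} → (s ∷ p ⊆ s ∷ q) ⇔ (p ⊆ q)
∷-⊆-cancel true  = ⇔.sym in⊆in-⇔
∷-⊆-cancel false = ⇔.sym out⊆-⇔

inside∷p⊈outside∷q : {p q : Subset n} → true ∷ p ⊈ false ∷ q
inside∷p⊈outside∷q p⊆q with p⊆q here
... | ()

∷-⊆-cong : ∀ s t {p q : Subset m} {p′ q′ : Subset n} →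
           (p ⊆ q ⇔ p′ ⊆ q′) → (s ∷ p ⊆ t ∷ q) ⇔ (s ∷ p′ ⊆ t ∷ q′)
∷-⊆-cong true  true  p⊆q⇔p′⊆q′ = ⇔.trans (∷-⊆-cancel true) (⇔.trans p⊆q⇔p′⊆q′ in⊆in-⇔)
∷-⊆-cong false t     p⊆q⇔p′⊆q′ = ⇔.trans (⇔.sym out⊆-⇔) (⇔.trans p⊆q⇔p′⊆q′ out⊆-⇔)
∷-⊆-cong true  false _         = mk⇔ (⊥-elim ∘ inside∷p⊈outside∷q) (⊥-elim ∘ inside∷p⊈outside∷q)

extend-⊆ : (F c : Subset n) (B B′ : Subset ∣ ∁ F ∣) → (extend F c B ⊆ extend F c B′) ⇔ (B ⊆ B′)
extend-⊆ []          []      []      []        = ⇔.refl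
extend-⊆ (true  ∷ F) (a ∷ c) B       B′        = ⇔.trans (∷-⊆-cancel a) (extend-⊆ F c B B′)
extend-⊆ (false ∷ F) (_ ∷ c) (b ∷ B) (b′ ∷ B′) = ∷-⊆-cong b b′ (extend-⊆ F c B B′)

restrict-⊆ : (F c : Subset n) {A B : Subset n} → AgreeOn F A c → AgreeOn F B c →
             (A ⊆ B) ⇔ (restrict F A ⊆ restrict F B)
restrict-⊆ F c {A} {B} A~c B~c =
  subst₂ (λ A′ B′ → (A′ ⊆ B′) ⇔ (restrict F A ⊆ restrict F B))
         (extend-restrict F A c A~c) (extend-restrict F B c B~c)
         (extend-⊆ F c (restrict F A) (restrict F B))

∣restrict∣ : (F c : Subset n) {A : Subset n} → AgreeOn F A c → ∣ A ∣ ≡ ∣ F ∩ c ∣ + ∣ restrict F A ∣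
∣restrict∣ F c {A} A~c =
  subst (λ A′ → ∣ A′ ∣ ≡ ∣ F ∩ c ∣ + ∣ restrict F A ∣) (extend-restrict F A c A~c)
        (∣extend∣ F c (restrict F A))

∣p∣≡∣p∩q∣+∣p∩∁q∣ : (p q : Subset n) → ∣ p ∣ ≡ ∣ p ∩ q ∣ + ∣ p ∩ ∁ q ∣
∣p∣≡∣p∩q∣+∣p∩∁q∣ []          []          = refl
∣p∣≡∣p∩q∣+∣p∩∁q∣ (true  ∷ p) (true  ∷ q) = cong suc (∣p∣≡∣p∩q∣+∣p∩∁q∣ p q)
∣p∣≡∣p∩q∣+∣p∩∁q∣ (true  ∷ p) (false ∷ q) = trans (cong suc (∣p∣≡∣p∩q∣+∣p∩∁q∣ p q)) (sym (+-suc _ _))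
∣p∣≡∣p∩q∣+∣p∩∁q∣ (false ∷ p) (_     ∷ q) = ∣p∣≡∣p∩q∣+∣p∩∁q∣ p q

-- Middle layers

size-shift : {j k s : ℕ} → j ≤ k → (j + s ≡ k) ⇔ (s ≡ k ∸ j)
size-shift {j} {k} {s} j≤k = mk⇔
  (λ j+s≡k → trans (sym (m+n∸m≡n j s)) (cong (_∸ j) j+s≡k))
  (λ s≡k∸j → trans (cong (j +_) s≡k∸j) (m+[n∸m]≡n j≤k))

size-shiftˢ : {j k s : ℕ} → j ≤ k → (j + s ≡ suc k) ⇔ (s ≡ suc (k ∸ j))
size-shiftˢ {j} {k} {s} j≤k =
  subst (λ t → (j + s ≡ suc k) ⇔ (s ≡ t)) (+-∸-assoc 1 j≤k) (size-shift (m≤n⇒m≤1+n j≤k))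

IsVertex-shift : ∀ {j k} {A : Subset (dim k)} {a : Subset (dim (k ∸ j))} →
                 j ≤ k → ∣ A ∣ ≡ j + ∣ a ∣ → IsVertex k A ⇔ IsVertex (k ∸ j) a
IsVertex-shift j≤k ∣A∣≡j+∣a∣ rewrite ∣A∣≡j+∣a∣ = size-shift j≤k ⊎-⇔ size-shiftˢ j≤k

Adj-shift : ∀ {j k} {A B : Subset (dim k)} {a b : Subset (dim (k ∸ j))} →
            j ≤ k → ∣ A ∣ ≡ j + ∣ a ∣ → ∣ B ∣ ≡ j + ∣ b ∣ →
            (A ⊆ B ⇔ a ⊆ b) → (B ⊆ A ⇔ b ⊆ a) → Adj k A B ⇔ Adj (k ∸ j) a b
Adj-shift j≤k ∣A∣≡j+∣a∣ ∣B∣≡j+∣b∣ A⊆B⇔a⊆b B⊆A⇔b⊆a rewrite ∣A∣≡j+∣a∣ | ∣B∣≡j+∣b∣ =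
      (size-shift j≤k ×-⇔ size-shiftˢ j≤k ×-⇔ A⊆B⇔a⊆b)
  ⊎-⇔ (size-shift j≤k ×-⇔ size-shiftˢ j≤k ×-⇔ B⊆A⇔b⊆a)

dim-∸ : ∀ {j k} → j ≤ k → dim k ∸ (j + j) ≡ dim (k ∸ j)
dim-∸ {j} {k} j≤k = begin
  dim k ∸ (j + j)                  ≡⟨ cong (λ t → dim t ∸ (j + j)) (m∸n+n≡m j≤k) ⟨
  dim (k ∸ j + j) ∸ (j + j)        ≡⟨ cong (_∸ (j + j)) (dim-+ (k ∸ j) j) ⟩
  dim (k ∸ j) + (j + j) ∸ (j + j)  ≡⟨ m+n∸n≡m (dim (k ∸ j)) (j + j) ⟩
  dim (k ∸ j)                      ∎
  where
  open ≡-Reasoning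
  dim-+ : ∀ t j → dim (t + j) ≡ dim t + (j + j)
  dim-+ = solve 2 (λ t j → con 1 :+ con 2 :* (t :+ j) := (con 1 :+ con 2 :* t) :+ (j :+ j)) refl
    where open +-*-Solver

IsVertex⇒bounds : ∀ {k} {A : Subset (dim k)} → IsVertex k A → k ≤ ∣ A ∣ × k ≤ ∣ ∁ A ∣
IsVertex⇒bounds {k} {A} A-vtx = k≤∣A∣ A-vtx , (begin
  k                ≡⟨ +-identityʳ k ⟨
  k + 0            ≡⟨ m+n∸m≡n k (k + 0) ⟨
  dim k ∸ suc k    ≤⟨ ∸-monoʳ-≤ (dim k) (∣A∣≤1+k A-vtx) ⟩
  dim k ∸ ∣ A ∣    ≡⟨ ∣∁p∣≡n∸∣p∣ A ⟨
  ∣ ∁ A ∣          ∎)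
  where
  open ≤-Reasoning
  k≤∣A∣ : IsVertex k A → k ≤ ∣ A ∣
  k≤∣A∣ (inj₁ ∣A∣≡k)   = ≤-reflexive (sym ∣A∣≡k)
  k≤∣A∣ (inj₂ ∣A∣≡1+k) = ≤-trans (n≤1+n k) (≤-reflexive (sym ∣A∣≡1+k))
  ∣A∣≤1+k : IsVertex k A → ∣ A ∣ ≤ suc k
  ∣A∣≤1+k (inj₁ ∣A∣≡k)   = ≤-trans (≤-reflexive ∣A∣≡k) (n≤1+n k)
  ∣A∣≤1+k (inj₂ ∣A∣≡1+k) = ≤-reflexive ∣A∣≡1+k

quarter-bound : ∀ {m k} → 4 * m ≤ dim k → m ≤ k
quarter-bound {m} {k} 4m≤n = ≤-trans (m≤m+n m (m + 0)) (s≤s⁻¹ 2m<1+k)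
  where
  open ≤-Reasoning
  2m<1+k : 2 * m < suc k
  2m<1+k = *-cancelˡ-< 2 (2 * m) (suc k) (begin-strict
    2 * (2 * m)   ≡⟨ *-assoc 2 2 m ⟨
    4 * m         ≤⟨ 4m≤n ⟩
    dim k         <⟨ n<1+n (dim k) ⟩
    2 + 2 * k     ≡⟨ *-suc 2 k ⟨
    2 * suc k     ∎)

induced : (k : ℕ) → (Subset (dim k) → Set) → Subgraph k
induced k P = record
  { V  = Vertex
  ; E  = λ A B → Adj k A B × Vertex A × Vertex B
  ; V⊆ = λ _ → proj₁
  ; E⊆ = λ _ _ e → e
  }
  where
  Vertex : Subset (dim k) → Set
  Vertex A = IsVertex k A × P A

∣subst∣ : (e : m ≡ n) (B : Subset m) → ∣ subst Subset e B ∣ ≡ ∣ B ∣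
∣subst∣ refl B = refl

subst-⊆ : (e : m ≡ n) (B B′ : Subset m) → (B ⊆ B′) ⇔ (subst Subset e B ⊆ subst Subset e B′)
subst-⊆ refl B B′ = ⇔.refl

subcube≅M : (k j : ℕ) (F c : Subset (dim k)) → j ≤ k → ∣ F ∩ c ∣ ≡ j → ∣ F ∩ ∁ c ∣ ≡ j →
            IsoToM (induced k (λ A → AgreeOn F A c)) (k ∸ j)
subcube≅M k j F c j≤k ∣F∩c∣≡j ∣F∩∁c∣≡j = record
  { f     = f
  ; g     = g
  ; f-vtx = λ A (A-vtx , A~c) →
              Equivalence.to (IsVertex-shift {A = A} {f A} j≤k (∣A∣ A~c)) A-vtx
  ; g-vtx = λ B B-vtx → Equivalence.from (IsVertex-shift {A = g B} {B} j≤k (∣gB∣ B)) B-vtx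
                      , extend-agrees F c (cast⁻¹ B)
  ; gf    = λ A (_ , A~c) →
              trans (cong (extend F c) (subst-sym-subst free≡)) (extend-restrict F A c A~c)
  ; fg    = λ B _ → trans (cong cast (restrict-extend F c (cast⁻¹ B))) (subst-subst-sym free≡)
  ; edges = λ A B A∈ B∈ → mk⇔ (λ e → Equivalence.to (Adj≅ A∈ B∈) (proj₁ e))
                              (λ e → Equivalence.from (Adj≅ A∈ B∈) e , A∈ , B∈)
  }
  where
  free≡ : ∣ ∁ F ∣ ≡ dim (k ∸ j)
  free≡ = begin
    ∣ ∁ F ∣                           ≡⟨ ∣∁p∣≡n∸∣p∣ F ⟩
    dim k ∸ ∣ F ∣                     ≡⟨ cong (dim k ∸_) (∣p∣≡∣p∩q∣+∣p∩∁q∣ F c) ⟩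
    dim k ∸ (∣ F ∩ c ∣ + ∣ F ∩ ∁ c ∣) ≡⟨ cong₂ (λ a b → dim k ∸ (a + b)) ∣F∩c∣≡j ∣F∩∁c∣≡j ⟩
    dim k ∸ (j + j)                   ≡⟨ dim-∸ j≤k ⟩
    dim (k ∸ j)                       ∎
    where open ≡-Reasoning

  cast : Subset ∣ ∁ F ∣ → Subset (dim (k ∸ j))
  cast = subst Subset free≡
  cast⁻¹ : Subset (dim (k ∸ j)) → Subset ∣ ∁ F ∣
  cast⁻¹ = subst Subset (sym free≡)

  f : Subset (dim k) → Subset (dim (k ∸ j))
  f A = cast (restrict F A)
  g : Subset (dim (k ∸ j)) → Subset (dim k)
  g B = extend F c (cast⁻¹ B)

  ∣A∣ : {A : Subset (dim k)} → AgreeOn F A c → ∣ A ∣ ≡ j + ∣ f A ∣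
  ∣A∣ {A} A~c =
    trans (∣restrict∣ F c A~c) (cong₂ _+_ ∣F∩c∣≡j (sym (∣subst∣ free≡ (restrict F A))))
  ∣gB∣ : (B : Subset (dim (k ∸ j))) → ∣ g B ∣ ≡ j + ∣ B ∣
  ∣gB∣ B = trans (∣extend∣ F c (cast⁻¹ B)) (cong₂ _+_ ∣F∩c∣≡j (∣subst∣ (sym free≡) B))

  f-⊆ : {A B : Subset (dim k)} → AgreeOn F A c → AgreeOn F B c → (A ⊆ B) ⇔ (f A ⊆ f B)
  f-⊆ A~c B~c = ⇔.trans (restrict-⊆ F c A~c B~c) (subst-⊆ free≡ _ _)

  Adj≅ : {A B : Subset (dim k)} → IsVertex k A × AgreeOn F A c → IsVertex k B × AgreeOn F B c →
         Adj k A B ⇔ Adj (k ∸ j) (f A) (f B)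
  Adj≅ {A} {B} (_ , A~c) (_ , B~c) =
    Adj-shift {A = A} {B} {f A} {f B} j≤k (∣A∣ A~c) (∣A∣ B~c) (f-⊆ A~c B~c) (f-⊆ B~c A~c)

-- Separating coordinates

firstDifference : Subset n → Subset n → Subset n
firstDifference []          []          = []
firstDifference (true  ∷ x) (true  ∷ y) = false ∷ firstDifference x y
firstDifference (false ∷ x) (false ∷ y) = false ∷ firstDifference x y
firstDifference (true  ∷ _) (false ∷ _) = true ∷ ⊥
firstDifference (false ∷ _) (true  ∷ _) = true ∷ ⊥

firstDifference-comm : (x y : Subset n) → firstDifference x y ≡ firstDifference y x
firstDifference-comm []          []          = refl
firstDifference-comm (true  ∷ x) (true  ∷ y) = cong (false ∷_) (firstDifference-comm x y)
firstDifference-comm (false ∷ x) (false ∷ y) = cong (false ∷_) (firstDifference-comm x y)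
firstDifference-comm (true  ∷ _) (false ∷ _) = refl
firstDifference-comm (false ∷ _) (true  ∷ _) = refl

∣firstDifference-self∣ : (x : Subset n) → ∣ firstDifference x x ∣ ≡ 0
∣firstDifference-self∣ []          = refl
∣firstDifference-self∣ (true  ∷ x) = ∣firstDifference-self∣ x
∣firstDifference-self∣ (false ∷ x) = ∣firstDifference-self∣ x

∣firstDifference∣≤1 : (x y : Subset n) → ∣ firstDifference x y ∣ ≤ 1
∣firstDifference∣≤1         []          []          = z≤n
∣firstDifference∣≤1         (true  ∷ x) (true  ∷ y) = ∣firstDifference∣≤1 x y
∣firstDifference∣≤1         (false ∷ x) (false ∷ y) = ∣firstDifference∣≤1 x y
∣firstDifference∣≤1 {suc n} (true  ∷ _) (false ∷ _) = s≤s (≤-reflexive (∣⊥∣≡0 n))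
∣firstDifference∣≤1 {suc n} (false ∷ _) (true  ∷ _) = s≤s (≤-reflexive (∣⊥∣≡0 n))

firstDifference-separates : (x y : Subset n) → AgreeOn (firstDifference x y) x y → x ≡ y
firstDifference-separates []          []          _   = refl
firstDifference-separates (true  ∷ x) (true  ∷ y) x~y =
  cong (true ∷_) (firstDifference-separates x y (Vec.∷-injectiveʳ x~y))
firstDifference-separates (false ∷ x) (false ∷ y) x~y =
  cong (false ∷_) (firstDifference-separates x y (Vec.∷-injectiveʳ x~y))
firstDifference-separates (true  ∷ _) (false ∷ _) ()
firstDifference-separates (false ∷ _) (true  ∷ _) ()

∣p∪q∣≤∣p∣+∣q∣ : (p q : Subset n) → ∣ p ∪ q ∣ ≤ ∣ p ∣ + ∣ q ∣
∣p∪q∣≤∣p∣+∣q∣ []          []          = z≤n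
∣p∪q∣≤∣p∣+∣q∣ (true  ∷ p) (s     ∷ q) =
  s≤s (≤-trans (∣p∪q∣≤∣p∣+∣q∣ p q) (+-monoʳ-≤ ∣ p ∣ (∣p∣≤∣x∷p∣ s q)))
∣p∪q∣≤∣p∣+∣q∣ (false ∷ p) (true  ∷ q) =
  ≤-trans (s≤s (∣p∪q∣≤∣p∣+∣q∣ p q)) (≤-reflexive (sym (+-suc _ _)))
∣p∪q∣≤∣p∣+∣q∣ (false ∷ p) (false ∷ q) = ∣p∪q∣≤∣p∣+∣q∣ p q

separator : Subset n → List (Subset n) → Subset n
separator x ys = ⋃ (map (firstDifference x) ys)

firstDifference⊆separator : {x y : Subset n} {ys : List (Subset n)} →
                            y ∈ ys → firstDifference x y ⊆ separator x ys
firstDifference⊆separator {ys = _ ∷ ys} (Any.here refl) = p⊆p∪q (separator _ ys)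
firstDifference⊆separator {x = x} {ys = z ∷ _} (Any.there y∈ys) =
  ⊆-trans (firstDifference⊆separator y∈ys) (q⊆p∪q (firstDifference x z) _)

∣separator∣≤length : (x : Subset n) (ys : List (Subset n)) → ∣ separator x ys ∣ ≤ length ys
∣separator∣≤length {n} x []       = ≤-reflexive (∣⊥∣≡0 n)
∣separator∣≤length     x (y ∷ ys) =
  ≤-trans (∣p∪q∣≤∣p∣+∣q∣ (firstDifference x y) (separator x ys))
          (+-mono-≤ (∣firstDifference∣≤1 x y) (∣separator∣≤length x ys))

∣separator∣<length : {x : Subset n} {ys : List (Subset n)} → x ∈ ys → ∣ separator x ys ∣ < length ys
∣separator∣<length {x = x} {ys = _ ∷ ys} (Any.here refl) =
  s≤s (≤-trans (∣p∪q∣≤∣p∣+∣q∣ (firstDifference x x) (separator x ys))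
               (≤-trans (≤-reflexive (cong (_+ ∣ separator x ys ∣) (∣firstDifference-self∣ x)))
                        (∣separator∣≤length x ys)))
∣separator∣<length {x = x} {ys = y ∷ ys} (Any.there x∈ys) =
  s≤s (≤-trans (∣p∪q∣≤∣p∣+∣q∣ (firstDifference x y) (separator x ys))
               (≤-trans (+-monoˡ-≤ ∣ separator x ys ∣ (∣firstDifference∣≤1 x y))
                        (∣separator∣<length x∈ys)))

-- Padding

pad : Subset n → Subset n → ℕ → Subset n
pad []          []          _       = []
pad (_     ∷ U) (true  ∷ S) r       = true  ∷ pad U S r
pad (true  ∷ U) (false ∷ S) (suc r) = true  ∷ pad U S r
pad (true  ∷ U) (false ∷ S) zero    = false ∷ pad U S zero
pad (false ∷ U) (false ∷ S) r       = false ∷ pad U S r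

⊆-pad : (U S : Subset n) (r : ℕ) → S ⊆ pad U S r
⊆-pad []          []          _       = ⊆-refl
⊆-pad (_     ∷ U) (true  ∷ S) r       = in⊆in (⊆-pad U S r)
⊆-pad (true  ∷ U) (false ∷ S) (suc r) = out⊆ (⊆-pad U S r)
⊆-pad (true  ∷ U) (false ∷ S) zero    = out⊆ (⊆-pad U S zero)
⊆-pad (false ∷ U) (false ∷ S) r       = out⊆ (⊆-pad U S r)

∣pad∩U∣ : (U S : Subset n) (r : ℕ) → ∣ S ∩ U ∣ + r ≤ ∣ U ∣ → ∣ pad U S r ∩ U ∣ ≡ ∣ S ∩ U ∣ + r
∣pad∩U∣ []          []          zero    _          = refl
∣pad∩U∣ (true  ∷ U) (true  ∷ S) r       (s≤s room) = cong suc (∣pad∩U∣ U S r room)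
∣pad∩U∣ (false ∷ U) (true  ∷ S) r       room       = ∣pad∩U∣ U S r room
∣pad∩U∣ (true  ∷ U) (false ∷ S) (suc r) room       =
  trans (cong suc (∣pad∩U∣ U S r (s≤s⁻¹ (subst (_≤ suc ∣ U ∣) (+-suc _ r) room)))) (sym (+-suc _ r))
∣pad∩U∣ (true  ∷ U) (false ∷ S) zero    _          =
  ∣pad∩U∣ U S zero (≤-trans (≤-reflexive (+-identityʳ _)) (∣p∩q∣≤∣q∣ S U))
∣pad∩U∣ (false ∷ U) (false ∷ S) r       room       = ∣pad∩U∣ U S r room

pad∩∁U : (U S : Subset n) (r : ℕ) → pad U S r ∩ ∁ U ≡ S ∩ ∁ U
pad∩∁U []          []          _       = refl
pad∩∁U (u     ∷ U) (true  ∷ S) r       = cong (not u ∷_) (pad∩∁U U S r)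
pad∩∁U (true  ∷ U) (false ∷ S) (suc r) = cong (false ∷_) (pad∩∁U U S r)
pad∩∁U (true  ∷ U) (false ∷ S) zero    = cong (false ∷_) (pad∩∁U U S zero)
pad∩∁U (false ∷ U) (false ∷ S) r       = cong (false ∷_) (pad∩∁U U S r)

∁-involutive : (p : Subset n) → ∁ (∁ p) ≡ p
∁-involutive p =
  trans (sym (Vec.map-∘ not not p)) (trans (Vec.map-cong not-involutive p) (Vec.map-id p))

balanced : ℕ → Subset n → Subset n → Subset n
balanced j c S = pad (∁ c) (pad c S (j ∸ ∣ S ∩ c ∣)) (j ∸ ∣ S ∩ ∁ c ∣)

⊆-balanced : (j : ℕ) (c S : Subset n) → S ⊆ balanced j c S
⊆-balanced j c S = ⊆-trans (⊆-pad c S _) (⊆-pad (∁ c) _ _)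

∣balanced∩c∣ : {j : ℕ} (c S : Subset n) → ∣ S ∣ ≤ j → j ≤ ∣ c ∣ → j ≤ ∣ ∁ c ∣ →
               ∣ balanced j c S ∩ c ∣ ≡ j × ∣ balanced j c S ∩ ∁ c ∣ ≡ j
∣balanced∩c∣ {j = j} c S ∣S∣≤j j≤∣c∣ j≤∣∁c∣ = ∣F∩c∣ , ∣F∩∁c∣
  where
  S₁ = pad c S (j ∸ ∣ S ∩ c ∣)
  F  = pad (∁ c) S₁ (j ∸ ∣ S ∩ ∁ c ∣)

  top-up : ∀ {m} → m ≤ j → m + (j ∸ m) ≡ j
  top-up = m+[n∸m]≡n

  ∣S∩c∣≤j : ∣ S ∩ c ∣ ≤ j
  ∣S∩c∣≤j = ≤-trans (∣p∩q∣≤∣p∣ S c) ∣S∣≤j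
  ∣S∩∁c∣≤j : ∣ S ∩ ∁ c ∣ ≤ j
  ∣S∩∁c∣≤j = ≤-trans (∣p∩q∣≤∣p∣ S (∁ c)) ∣S∣≤j

  ∣S₁∩c∣ : ∣ S₁ ∩ c ∣ ≡ j
  ∣S₁∩c∣ = trans (∣pad∩U∣ c S _ (subst (_≤ ∣ c ∣) (sym (top-up ∣S∩c∣≤j)) j≤∣c∣)) (top-up ∣S∩c∣≤j)

  S₁∩∁c : S₁ ∩ ∁ c ≡ S ∩ ∁ c
  S₁∩∁c = pad∩∁U c S _

  ∣F∩c∣ : ∣ F ∩ c ∣ ≡ j
  ∣F∩c∣ = begin
    ∣ F ∩ c ∣            ≡⟨ cong (λ c′ → ∣ F ∩ c′ ∣) (∁-involutive c) ⟨
    ∣ F ∩ ∁ (∁ c) ∣      ≡⟨ cong ∣_∣ (pad∩∁U (∁ c) S₁ _) ⟩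
    ∣ S₁ ∩ ∁ (∁ c) ∣     ≡⟨ cong (λ c′ → ∣ S₁ ∩ c′ ∣) (∁-involutive c) ⟩
    ∣ S₁ ∩ c ∣           ≡⟨ ∣S₁∩c∣ ⟩
    j                    ∎
    where open ≡-Reasoning

  ∣F∩∁c∣ : ∣ F ∩ ∁ c ∣ ≡ j
  ∣F∩∁c∣ = begin
    ∣ F ∩ ∁ c ∣                          ≡⟨ ∣pad∩U∣ (∁ c) S₁ _ room ⟩
    ∣ S₁ ∩ ∁ c ∣ + (j ∸ ∣ S ∩ ∁ c ∣)     ≡⟨ cong (λ s → ∣ s ∣ + (j ∸ ∣ S ∩ ∁ c ∣)) S₁∩∁c ⟩
    ∣ S ∩ ∁ c ∣ + (j ∸ ∣ S ∩ ∁ c ∣)      ≡⟨ top-up ∣S∩∁c∣≤j ⟩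
    j                                    ∎
    where
    open ≡-Reasoning
    room : ∣ S₁ ∩ ∁ c ∣ + (j ∸ ∣ S ∩ ∁ c ∣) ≤ ∣ ∁ c ∣
    room = subst (_≤ ∣ ∁ c ∣)
                 (sym (trans (cong (λ s → ∣ s ∣ + (j ∸ ∣ S ∩ ∁ c ∣)) S₁∩∁c) (top-up ∣S∩∁c∣≤j)))
                 j≤∣∁c∣

lemmaB1 : (k : ℕ) (X : List (Subset (dim k))) →
          Unique X → All (IsVertex k) X → 4 * length X ≤ dim k →
          Σ (Subset (dim k) → Subgraph k) λ M → ((∀ x y → x ∈ X → y ∈ X → x ≢ y → Disjoint {k} (M x) (M y))
                  × (∀ x → x ∈ X →
                       V (M x) x
                       × ∃[ j ] (2 * j ≤ 2 * (length X ∸ 1) × IsoToM {k} (M x) (k ∸ j))))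
-- Repetitions in X only weaken the size bound.
lemmaB1 k X _ X-vertices 4∣X∣≤n = M , disjoint , centred
  where
  j = length X ∸ 1

  frozen : Subset (dim k) → Subset (dim k)
  frozen x = balanced j x (separator x X)

  M : Subset (dim k) → Subgraph k
  M x = induced k (λ A → AgreeOn (frozen x) A x)

  firstDifference⊆frozen : ∀ {x y} → y ∈ X → firstDifference x y ⊆ frozen x
  firstDifference⊆frozen y∈X = ⊆-trans (firstDifference⊆separator y∈X) (⊆-balanced j _ _)

  disjoint : ∀ x y → x ∈ X → y ∈ X → x ≢ y → Disjoint (M x) (M y)
  disjoint x y x∈X y∈X x≢y A (_ , A~x) (_ , A~y) = x≢y (firstDifference-separates x y x~y)
    where
    firstDifference⊆frozen-y : firstDifference x y ⊆ frozen y
    firstDifference⊆frozen-y =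
      subst (_⊆ frozen y) (firstDifference-comm y x) (firstDifference⊆frozen x∈X)
    x~y : AgreeOn (firstDifference x y) x y
    x~y = trans (sym (AgreeOn-antimono (firstDifference⊆frozen y∈X) A~x))
                (AgreeOn-antimono firstDifference⊆frozen-y A~y)

  centred : ∀ x → x ∈ X → V (M x) x × ∃[ j ] (2 * j ≤ 2 * (length X ∸ 1) × IsoToM (M x) (k ∸ j))
  centred x x∈X = (x-vtx , refl) , j , ≤-refl ,
                  subcube≅M k j (frozen x) x j≤k (proj₁ counts) (proj₂ counts)
    where
    x-vtx : IsVertex k x
    x-vtx = All.lookup X-vertices x∈X
    j≤k : j ≤ k
    j≤k = ≤-trans (m∸n≤m (length X) 1) (quarter-bound 4∣X∣≤n)
    x-bounds : k ≤ ∣ x ∣ × k ≤ ∣ ∁ x ∣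
    x-bounds = IsVertex⇒bounds {A = x} x-vtx
    counts : ∣ frozen x ∩ x ∣ ≡ j × ∣ frozen x ∩ ∁ x ∣ ≡ j
    counts = ∣balanced∩c∣ x (separator x X) (<⇒≤pred (∣separator∣<length x∈X))
               (≤-trans j≤k (proj₁ x-bounds)) (≤-trans j≤k (proj₂ x-bounds))
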